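{- Let $G$ be a theta graph with branch vertices $u,v$, let $L$ be a list assignment on $G$ with $|L(x)|=4$ for all $x$, with colours indexed as $L(u)=\{c_0,c_1,c_2,c_3\}$, $L(v)=\{c'_0,c'_1,c'_2,c'_3\}$ so that $c'_j=c_j$ whenever $c_j\in L(u)\cap L(v)$. Let $P$ be an internal path of $G$ with an odd number of vertices. Then $P$ blocks at most $2$ simple pairs, and if $P$ blocks $2$ simple pairs, then $S_L(P)=2|V(P)|+2$ and $P$ has one heavy couple and two light couples.
   Context: A theta graph consists of two vertices $u,v$ joined by internally vertex-disjoint paths (each of length at least 2); an internal path is one of these $u$–$v$ paths with $u$ and $v$ deleted, written $P=v_1\cdots v_n$ with $v_1$ adjacent to $u$ and $v_n$ adjacent to $v$. For such $P$: $X_1=L(v_1)$, $X_i=L(v_i)\setminus X_{i-1}$ ($i>1$), $S_L(P)=\sum_i|X_i|$. For colour sets $p,q$, $L^{p,q}$ is $L$ with colours of $p$ deleted from $L(v_1)$ and of $q$ deleted from $L(v_n)$ (both from $L(v_1)$ if $n=1$); the damage is $\mathrm{dam}_{L,P}(p,q)=S_L(P)-S_{L^{p,q}}(P)$. A couple is a pair $c_jc'_j$. A simple pair is a pair $(p,q)$ of $2$-element sets $p\subset L(u)$, $q\subset L(v)$ such that for all $j$, $c_j\in p$ iff $c'_j\in q$. $P$ blocks $(p,q)$ if $\mathrm{dam}_{L,P}(p,q)>S_L(P)-2|V(P)|$. The couple $c_jc'_j$ is heavy, light, or safe for $P$ if $\mathrm{dam}_{L,P}(\{c_j\},\{c'_j\})$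 equals $2$, $1$, or $0$ respectively. -}

module Defs where

open import Data.Nat using (ℕ; zero; suc; _+_; _*_)
open import Data.Integer using (ℤ; +_; _-_; _<_) renaming (_≟_ to _≟ℤ_)
open import Data.Fin using (Fin)
open import Data.Fin.Subset using (Subset; ∣_∣)
open import Data.Fin.Subset.Properties using () renaming (_∈?_ to _∈?ₛ_)
open import Data.List using (List; []; _∷_; length; filter; map; allFin)
open import Data.List.Membership.DecPropositional Data.Nat._≟_ using (_∈_; _∈?_)
open import Data.Vec using (Vec; lookup)
open import Data.Product using (_×_; Σ; ∃)
open import Function.Bundles using (_⇔_)
open import Relation.Nullary using (¬?)
open import Relation.Binary.PropositionalEquality using (_≡_)

-- Colours are natural numbers; a list L(x) is a duplicate-free List ℕ.
-- An internal path P = v₁ ⋯ vₙ is represented by the list of its vertex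
-- lists  L(v₁) ∷ ⋯ ∷ L(vₙ) ∷ [].

remove : List ℕ → List ℕ → List ℕ
remove ds l = filter (λ x → ¬? (x ∈? ds)) l

-- S' X_{i-1} (L(v_i) ∷ …) = Σ_{j ≥ i} |X_j|   where X_j = L(v_j) \ X_{j-1}
S' : List ℕ → List (List ℕ) → ℕ
S' prev [] = 0
S' prev (l ∷ ls) = length (remove prev l) + S' (remove prev l) ls

S : List (List ℕ) → ℕ
S P = S' [] P

onHead : (List ℕ → List ℕ) → List (List ℕ) → List (List ℕ)
onHead f [] = []
onHead f (x ∷ xs) = f x ∷ xs

onLast : (List ℕ → List ℕ) → List (List ℕ) → List (List ℕ)
onLast f [] = []
onLast f (x ∷ []) = f x ∷ []
onLast f (x ∷ y ∷ ys) = x ∷ onLast f (y ∷ ys)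

-- L^{p,q} restricted to P: delete p from L(v₁) and q from L(vₙ)
-- (both from L(v₁) when n = 1)
restrictPQ : List ℕ → List ℕ → List (List ℕ) → List (List ℕ)
restrictPQ p q P = onLast (remove q) (onHead (remove p) P)

dam : List (List ℕ) → List ℕ → List ℕ → ℤ
dam P p q = + S P - + S (restrictPQ p q P)

Blocks : List (List ℕ) → List ℕ → List ℕ → Set
Blocks P p q = + S P - + (2 * length P) < dam P p q

-- A subset of L(u) = {c₀,…,c₃} is given by the set of indices of its colours
-- (c is injective); colsOf c s is the corresponding set of colours.
colsOf : Vec ℕ 4 → Subset 4 → List ℕ
colsOf c s = map (lookup c) (filter (_∈?ₛ s) (allFin 4))

SimplePair : (c c' : Vec ℕ 4) → Subset 4 → Subset 4 → Set
SimplePair c c' p q =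
  ∣ p ∣ ≡ 2 × ∣ q ∣ ≡ 2 ×
  ((j : Fin 4) → (lookup c j ∈ colsOf c p) ⇔ (lookup c' j ∈ colsOf c' q))

BlockedSimple : List (List ℕ) → (c c' : Vec ℕ 4) → Subset 4 → Subset 4 → Set
BlockedSimple P c c' p q =
  SimplePair c c' p q × Blocks P (colsOf c p) (colsOf c' q)

coupleDam : List (List ℕ) → (c c' : Vec ℕ 4) → Fin 4 → ℤ
coupleDam P c c' j = dam P (lookup c j ∷ []) (lookup c' j ∷ [])

-- number of couples c_j c'_j with damage k (k = 2 heavy, 1 light, 0 safe)
numCouples : List (List ℕ) → (c c' : Vec ℕ 4) → ℕ → ℕ
numCouples P c c' k = length (filter (λ j → coupleDam P c c' j ≟ℤ + k) (allFin 4))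

Odd : ℕ → Set
Odd n = ∃ λ m → n ≡ suc (2 * m)

-- Count S_L(P) colour by colour: colour a contributes #{i | a ∈ Xᵢ}, a function of the
-- 0/1 sequence ([a ∈ L(vᵢ)])ᵢ alone. Deleting the couple c_j c'_j at the ends of P only
-- changes the contributions of c_j and c'_j, each by at most one, so its damage κⱼ lies in
-- [0, 2], and damages of distinct couples add up because couples share no colour. With
-- |V(P)| = 2m + 1 and |L(vᵢ)| = 4 the odd positions give S_L(P) = 4(m + 1) + σ with σ ≥ 0,
-- and since trimming the (odd) ends never touches the even positions, Σⱼ κⱼ ≤ σ + 4.
-- A blocked simple pair is {c_a, c_b} × {c'_a, c'_b} with κ_a + κ_b ≥ σ + 3; under these
-- constraints a finite check shows that at most two pairs qualify, and two of them force
-- σ = 0 and damages 2, 1, 1, 0.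
module Submission where

open import Defs
open import Data.Bool using (Bool; true; false; _∧_; _∨_; not; T)
open import Data.Bool.Properties using (∨-identityʳ; ∧-identityʳ; ∧-zeroʳ)
open import Data.Empty using (⊥-elim)
open import Data.Fin using (Fin; zero; suc; toℕ; fromℕ<)
open import Data.Fin.Patterns using (0F; 1F; 2F; 3F; 4F; 5F)
import Data.Fin.Properties as Fin
open import Data.Fin.Properties using (all?)
open import Data.Fin.Subset using (Subset; ⁅_⁆; _∪_)
import Data.Fin.Subset as Subset
open import Data.Fin.Subset.Properties using (⊆-antisym) renaming (_∈?_ to _∈?ˢ_)
import Data.Integer as ℤ
import Data.Integer.Properties as ℤ
open import Data.List using (List; []; _∷_; length; map; filter; concat; allFin)
open import Data.List.Extrema.Nat using (max; xs≤max)
open import Data.List.Membership.Propositional.Properties using (∈-filter⁺; ∈-filter⁻; ∈-map⁺; ∈-map⁻; ∈-allFin)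
open import Data.List.Properties using (length-map; filter-≐)
open import Data.List.Relation.Unary.All using (All; []; _∷_)
import Data.List.Relation.Unary.All as All
import Data.List.Relation.Unary.All.Properties as All
open import Data.List.Relation.Unary.Unique.Propositional using (Unique; []; _∷_)
import Data.List.Relation.Unary.Unique.Propositional.Properties as Unique
open import Data.Nat using (ℕ; zero; suc; _+_; _*_; _∸_; _≤_; _<_; _≡ᵇ_; _<ᵇ_; z≤n; s≤s; ⌊_/2⌋; ⌈_/2⌉; _≟_; _≤?_)
open import Data.Nat.Properties
open import Data.List.Membership.DecPropositional _≟_ using (_∈_; _∈?_)
open import Algebra.Properties.CommutativeSemigroup +-commutativeSemigroup using (xy∙z≈xz∙y; interchange)
open import Algebra.Properties.Semiring.Sum +-*-semiring
  using (sum-syntax; ∑-distrib-+; ∑-comm; sum-cong-≗; sum-replicate-zero; *-distribˡ-sum)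
open import Data.Nat.Tactic.RingSolver using (solve-∀)
open import Data.Product using (Σ; _×_; _,_; proj₁; proj₂; uncurry; map₁)
open import Data.Sum using (_⊎_; inj₁; inj₂; [_,_]′)
open import Data.Vec using (Vec; []; _∷_; lookup; toList; tabulate)
open import Data.Vec.Membership.Propositional.Properties using (∈-lookup; ∈-toList⁺)
open import Data.Vec.Properties using (lookup∘tabulate; length-toList)
import Data.Vec.Relation.Unary.All as VecAll
import Data.Vec.Relation.Unary.All.Properties as VecAll
open import Function using (_∘_; id)
open import Function.Bundles using (mk⇔; Equivalence)
open import Relation.Nullary using (¬_; Dec; does; yes; no; ¬?; _×-dec_; _→-dec_; _⊎-dec_; contradiction)
open import Relation.Nullary.Decidable using (does-⇔; dec-false; toWitness)
open import Relation.Binary.PropositionalEquality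

-- One colour along a path

χ : Bool → ℕ
χ false = 0
χ true  = 1

_∖_ : Bool → Bool → Bool
b ∖ true  = false
b ∖ false = b

∧-not≡∖ : ∀ b h → b ∧ not h ≡ b ∖ h
∧-not≡∖ b true  = ∧-zeroʳ b
∧-not≡∖ b false = ∧-identityʳ b

-- For one colour a, with bᵢ = [a ∈ L(vᵢ)] and x = [a ∈ X₀], countX x (b₁ ⋯ bₙ) = #{i | a ∈ Xᵢ}.
countX : Bool → List Bool → ℕ
countX x []       = 0
countX x (b ∷ bs) = χ (b ∖ x) + countX (b ∖ x) bs

countX-true≤false     : ∀ bs → countX true bs ≤ countX false bs
countX-false≤suc-true : ∀ bs → countX false bs ≤ suc (countX true bs)
countX-true≤false []           = z≤n
countX-true≤false (true  ∷ bs) = countX-false≤suc-true bs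
countX-true≤false (false ∷ bs) = ≤-refl
countX-false≤suc-true []           = z≤n
countX-false≤suc-true (true  ∷ bs) = s≤s (countX-true≤false bs)
countX-false≤suc-true (false ∷ bs) = n≤1+n _

module _ {A : Set} where

  mapHead : (A → A) → List A → List A
  mapHead f []       = []
  mapHead f (x ∷ xs) = f x ∷ xs

  mapLast : (A → A) → List A → List A
  mapLast f []           = []
  mapLast f (x ∷ [])     = f x ∷ []
  mapLast f (x ∷ y ∷ ys) = x ∷ mapLast f (y ∷ ys)

  oddSum evenSum : (A → ℕ) → List A → ℕ
  oddSum f []        = 0
  oddSum f (x ∷ xs)  = f x + evenSum f xs
  evenSum f []       = 0
  evenSum f (x ∷ xs) = oddSum f xs

  length-mapHead : ∀ f xs → length (mapHead f xs) ≡ length xs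
  length-mapHead f []       = refl
  length-mapHead f (x ∷ xs) = refl

  evenSum-mapHead : ∀ f g xs → evenSum f (mapHead g xs) ≡ evenSum f xs
  evenSum-mapHead f g []       = refl
  evenSum-mapHead f g (x ∷ xs) = refl

  evenSum-mapLast : ∀ f g m xs → length xs ≡ suc (m + m) → evenSum f (mapLast g xs) ≡ evenSum f xs
  oddSum-mapLast  : ∀ f g m xs → length xs ≡ m + m → oddSum f (mapLast g xs) ≡ oddSum f xs
  evenSum-mapLast f g m       (x ∷ [])     _  = refl
  evenSum-mapLast f g m       (x ∷ y ∷ ys) eq = oddSum-mapLast f g m (y ∷ ys) (suc-injective eq)
  oddSum-mapLast  f g m       []           _  = refl
  oddSum-mapLast  f g zero    (x ∷ ys)     ()
  oddSum-mapLast  f g (suc m) (x ∷ [])     eq = ⊥-elim (0≢1+n (trans (suc-injective eq) (+-suc m m)))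
  oddSum-mapLast  f g (suc m) (x ∷ y ∷ ys) eq =
    cong (f x +_) (evenSum-mapLast f g m (y ∷ ys) (trans (suc-injective eq) (+-suc m m)))

  oddSum-const  : ∀ f k xs → All (λ x → f x ≡ k) xs → oddSum f xs ≡ k * ⌈ length xs /2⌉
  evenSum-const : ∀ f k xs → All (λ x → f x ≡ k) xs → evenSum f xs ≡ k * ⌊ length xs /2⌋
  oddSum-const f k []       []         = sym (*-zeroʳ k)
  oddSum-const f k (x ∷ xs) (fx ∷ fxs) =
    trans (cong₂ _+_ fx (evenSum-const f k xs fxs)) (sym (*-suc k ⌊ length xs /2⌋))
  evenSum-const f k []       []         = sym (*-zeroʳ k)
  evenSum-const f k (x ∷ xs) (_  ∷ fxs) = oddSum-const f k xs fxs

-- The occurrences of one colour in L^{p,q}: it is deleted from L(v₁) if hp and from L(vₙ) if hq.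
trim : Bool → Bool → List Bool → List Bool
trim hp hq bs = mapLast (_∖ hq) (mapHead (_∖ hp) bs)

trim-false-false : ∀ bs → trim false false bs ≡ bs
trim-false-false []       = refl
trim-false-false (b ∷ bs) = mapLast-∖false b bs
  where
  mapLast-∖false : ∀ b bs → mapLast (_∖ false) (b ∷ bs) ≡ b ∷ bs
  mapLast-∖false b []        = refl
  mapLast-∖false b (b' ∷ bs) = cong (b ∷_) (mapLast-∖false b' bs)

countX-mapHead-≤ : ∀ h bs → countX false (mapHead (_∖ h) bs) ≤ countX false bs
countX-mapHead-≤ h     []           = z≤n
countX-mapHead-≤ false (b ∷ bs)     = ≤-refl
countX-mapHead-≤ true  (false ∷ bs) = ≤-refl
countX-mapHead-≤ true  (true  ∷ bs) = countX-false≤suc-true bs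

countX-≤-mapHead : ∀ h bs → countX false bs ≤ countX false (mapHead (_∖ h) bs) + χ h
countX-≤-mapHead h     []           = z≤n
countX-≤-mapHead false (b ∷ bs)     = m≤m+n _ 0
countX-≤-mapHead true  (false ∷ bs) = m≤m+n _ 1
countX-≤-mapHead true  (true  ∷ bs) = ≤-trans (s≤s (countX-true≤false bs)) (≤-reflexive (+-comm 1 _))

countX-mapLast-≤ : ∀ h x bs → countX x (mapLast (_∖ h) bs) ≤ countX x bs
countX-mapLast-≤ h     x     []            = z≤n
countX-mapLast-≤ false x     (b ∷ [])      = ≤-refl
countX-mapLast-≤ true  true  (b ∷ [])      = z≤n
countX-mapLast-≤ true  false (b ∷ [])      = z≤n
countX-mapLast-≤ h     x     (b ∷ b' ∷ bs) = +-monoʳ-≤ (χ (b ∖ x)) (countX-mapLast-≤ h (b ∖ x) (b' ∷ bs))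

countX-≤-mapLast : ∀ h x bs → countX x bs ≤ countX x (mapLast (_∖ h) bs) + χ h
countX-≤-mapLast h     x     []            = z≤n
countX-≤-mapLast false x     (b ∷ [])      = m≤m+n _ 0
countX-≤-mapLast true  true  (b ∷ [])      = z≤n
countX-≤-mapLast true  false (true ∷ [])   = ≤-refl
countX-≤-mapLast true  false (false ∷ [])  = z≤n
countX-≤-mapLast h     x     (b ∷ b' ∷ bs) = begin
  χ (b ∖ x) + countX (b ∖ x) (b' ∷ bs)
    ≤⟨ +-monoʳ-≤ (χ (b ∖ x)) (countX-≤-mapLast h (b ∖ x) (b' ∷ bs)) ⟩
  χ (b ∖ x) + (countX (b ∖ x) (mapLast (_∖ h) (b' ∷ bs)) + χ h)
    ≡⟨ +-assoc (χ (b ∖ x)) _ (χ h) ⟨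
  χ (b ∖ x) + countX (b ∖ x) (mapLast (_∖ h) (b' ∷ bs)) + χ h ∎
  where open ≤-Reasoning

countX-trim-≤ : ∀ hp hq bs → countX false (trim hp hq bs) ≤ countX false bs
countX-trim-≤ hp hq bs = ≤-trans (countX-mapLast-≤ hq false (mapHead (_∖ hp) bs)) (countX-mapHead-≤ hp bs)

countX-≤-trim : ∀ hp hq bs → countX false bs ≤ countX false (trim hp hq bs) + χ hp + χ hq
countX-≤-trim hp hq bs = begin
  countX false bs
    ≤⟨ countX-≤-mapHead hp bs ⟩
  countX false (mapHead (_∖ hp) bs) + χ hp
    ≤⟨ +-monoˡ-≤ (χ hp) (countX-≤-mapLast hq false (mapHead (_∖ hp) bs)) ⟩
  countX false (trim hp hq bs) + χ hq + χ hp
    ≡⟨ xy∙z≈xz∙y (countX false (trim hp hq bs)) (χ hq) (χ hp) ⟩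
  countX false (trim hp hq bs) + χ hp + χ hq ∎
  where open ≤-Reasoning

oddSum≤countX  : ∀ x bs → oddSum χ bs ≤ χ x + countX x bs
evenSum≤countX : ∀ x bs → evenSum χ bs ≤ countX x bs
oddSum≤countX x []       = z≤n
oddSum≤countX x (b ∷ bs) = begin
  χ b + evenSum χ bs                   ≤⟨ +-mono-≤ (χ≤χ+χ∖ x b) (evenSum≤countX (b ∖ x) bs) ⟩
  χ x + χ (b ∖ x) + countX (b ∖ x) bs  ≡⟨ +-assoc (χ x) _ _ ⟩
  χ x + countX x (b ∷ bs)              ∎
  where
  open ≤-Reasoning
  χ≤χ+χ∖ : ∀ x b → χ b ≤ χ x + χ (b ∖ x)
  χ≤χ+χ∖ true  true  = ≤-refl
  χ≤χ+χ∖ true  false = z≤n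
  χ≤χ+χ∖ false b     = ≤-refl
evenSum≤countX x []       = z≤n
evenSum≤countX x (b ∷ bs) = oddSum≤countX (b ∖ x) bs

evenSum≤countX-trim : ∀ m hp hq bs → length bs ≡ suc (m + m) → evenSum χ bs ≤ countX false (trim hp hq bs)
evenSum≤countX-trim m hp hq bs length-bs = begin
  evenSum χ bs                    ≡⟨ evenSum-mapHead χ (_∖ hp) bs ⟨
  evenSum χ (mapHead (_∖ hp) bs)  ≡⟨ evenSum-mapLast χ (_∖ hq) m (mapHead (_∖ hp) bs)
                                       (trans (length-mapHead (_∖ hp) bs) length-bs) ⟨
  evenSum χ (trim hp hq bs)       ≤⟨ evenSum≤countX false (trim hp hq bs) ⟩
  countX false (trim hp hq bs)    ∎
  where open ≤-Reasoning

χ≤1 : ∀ b → χ b ≤ 1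
χ≤1 false = z≤n
χ≤1 true  = ≤-refl

χ-T : ∀ {b} → T b → χ b ≡ 1
χ-T {true} _ = refl

χ-∨ : ∀ b c → (T b → c ≡ false) → χ (b ∨ c) ≡ χ b + χ c
χ-∨ true  c disjoint rewrite disjoint _ = refl
χ-∨ false c _                           = refl

∑-χ-≡ᵇ : ∀ N x → ∑[ a < N ] χ (toℕ a ≡ᵇ x) ≡ χ (x <ᵇ N)
∑-χ-≡ᵇ zero    x       = refl
∑-χ-≡ᵇ (suc N) zero    = cong suc (sum-replicate-zero N)
∑-χ-≡ᵇ (suc N) (suc x) = ∑-χ-≡ᵇ N x

∑-mono-≤ : ∀ {n} {f g : Fin n → ℕ} → (∀ i → f i ≤ g i) → ∑[ i < n ] f i ≤ ∑[ i < n ] g i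
∑-mono-≤ {zero}  f≤g = z≤n
∑-mono-≤ {suc n} f≤g = +-mono-≤ (f≤g zero) (∑-mono-≤ (f≤g ∘ suc))

∑-const : ∀ n {f : Fin n → ℕ} {k} → (∀ i → f i ≡ k) → ∑[ i < n ] f i ≡ n * k
∑-const zero    f≡k = refl
∑-const (suc n) f≡k = cong₂ _+_ (f≡k zero) (∑-const n (f≡k ∘ suc))

∑-≥-all-but-one : ∀ n (f : Fin (suc n) → ℕ) {k e} → (∀ i → e ≤ f i) →
  (∀ i j → i ≢ j → f i ≡ k ⊎ f j ≡ k) → n * k + e ≤ ∑[ i < suc n ] f i
∑-≥-all-but-one zero    f e≤f _ = ≤-trans (e≤f zero) (m≤m+n _ 0)
∑-≥-all-but-one (suc n) f {k} {e} e≤f at-most-one with f zero ≟ k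
... | yes f₀≡k = begin
  k + n * k + e                      ≡⟨ +-assoc k (n * k) e ⟩
  k + (n * k + e)                    ≤⟨ +-mono-≤ (≤-reflexive (sym f₀≡k))
                                          (∑-≥-all-but-one n (f ∘ suc) (e≤f ∘ suc) at-most-one-suc) ⟩
  f zero + ∑[ i < suc n ] f (suc i)  ∎
  where
  open ≤-Reasoning
  at-most-one-suc : ∀ i j → i ≢ j → f (suc i) ≡ k ⊎ f (suc j) ≡ k
  at-most-one-suc i j i≢j = at-most-one (suc i) (suc j) (i≢j ∘ Fin.suc-injective)
... | no f₀≢k = begin
  suc n * k + e                      ≤⟨ +-monoʳ-≤ (suc n * k) (e≤f zero) ⟩
  suc n * k + f zero                 ≡⟨ +-comm (suc n * k) (f zero) ⟩
  f zero + suc n * k                 ≡⟨ cong (f zero +_) (∑-const (suc n) rest≡k) ⟨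
  f zero + ∑[ i < suc n ] f (suc i)  ∎
  where
  open ≤-Reasoning
  rest≡k : ∀ i → f (suc i) ≡ k
  rest≡k i = [ (λ f₀≡k → contradiction f₀≡k f₀≢k) , id ]′ (at-most-one zero (suc i) (λ ()))

-- Counting colour by colour

mem : ℕ → List ℕ → Bool
mem a l = does (a ∈? l)

mem-∷-≢ : ∀ {a x} xs → a ≢ x → mem a (x ∷ xs) ≡ mem a xs
mem-∷-≢ {a} {x} xs a≢x = cong (_∨ mem a xs) (dec-false (a ≟ x) a≢x)

mem-remove : ∀ a ds l → mem a (remove ds l) ≡ mem a l ∖ mem a ds
mem-remove a ds l = trans
  (does-⇔ (mk⇔ (∈-filter⁻ ∉ds?) (uncurry (∈-filter⁺ ∉ds?))) (a ∈? remove ds l) (a ∈? l ×-dec ¬? (a ∈? ds)))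
  (∧-not≡∖ (mem a l) (mem a ds))
  where
  ∉ds? : ∀ x → Dec (¬ x ∈ ds)
  ∉ds? x = ¬? (x ∈? ds)

∑χ-mem-singleton≤1 : ∀ N y → ∑[ a < N ] χ (mem (toℕ a) (y ∷ [])) ≤ 1
∑χ-mem-singleton≤1 N y = begin
  ∑[ a < N ] χ (mem (toℕ a) (y ∷ []))  ≡⟨ sum-cong-≗ {N} (λ a → cong χ (∨-identityʳ (toℕ a ≡ᵇ y))) ⟩
  ∑[ a < N ] χ (toℕ a ≡ᵇ y)            ≡⟨ ∑-χ-≡ᵇ N y ⟩
  χ (y <ᵇ N)                           ≤⟨ χ≤1 (y <ᵇ N) ⟩
  1                                    ∎
  where open ≤-Reasoning

UniqueBelow : ℕ → List ℕ → Set
UniqueBelow N l = Unique l × All (_< N) l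

remove-UniqueBelow : ∀ {N} ds {l} → UniqueBelow N l → UniqueBelow N (remove ds l)
remove-UniqueBelow ds (u , l<N) = Unique.filter⁺ ∉ds? u , All.filter⁺ ∉ds? l<N
  where
  ∉ds? : ∀ x → Dec (¬ x ∈ ds)
  ∉ds? x = ¬? (x ∈? ds)

length≡∑mem : ∀ N l → UniqueBelow N l → length l ≡ ∑[ a < N ] χ (mem (toℕ a) l)
length≡∑mem N []       _                       = sym (sum-replicate-zero N)
length≡∑mem N (x ∷ xs) (x∉xs ∷ u , x<N ∷ xs<N) = begin
  1 + length xs
    ≡⟨ cong₂ _+_ (sym (χ-T (<⇒<ᵇ x<N))) (length≡∑mem N xs (u , xs<N)) ⟩
  χ (x <ᵇ N) + ∑[ a < N ] χ (mem (toℕ a) xs)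
    ≡⟨ cong (_+ ∑[ a < N ] χ (mem (toℕ a) xs)) (∑-χ-≡ᵇ N x) ⟨
  ∑[ a < N ] χ (toℕ a ≡ᵇ x) + ∑[ a < N ] χ (mem (toℕ a) xs)
    ≡⟨ ∑-distrib-+ {N} (λ a → χ (toℕ a ≡ᵇ x)) (λ a → χ (mem (toℕ a) xs)) ⟨
  ∑[ a < N ] (χ (toℕ a ≡ᵇ x) + χ (mem (toℕ a) xs))
    ≡⟨ sum-cong-≗ {N} (λ a → χ-∨ (toℕ a ≡ᵇ x) _ (x∉xs-at a)) ⟨
  ∑[ a < N ] χ (mem (toℕ a) (x ∷ xs)) ∎
  where
  open ≡-Reasoning
  x∉xs-at : ∀ a → T (toℕ a ≡ᵇ x) → mem (toℕ a) xs ≡ false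
  x∉xs-at a a≡x = dec-false (toℕ a ∈? xs) λ a∈xs → All.lookup x∉xs (subst (_∈ xs) (≡ᵇ⇒≡ _ _ a≡x) a∈xs) refl

occurrences : ℕ → List (List ℕ) → List Bool
occurrences a = map (mem a)

S'≡∑countX : ∀ N prev P → All (UniqueBelow N) P →
  S' prev P ≡ ∑[ a < N ] countX (mem (toℕ a) prev) (occurrences (toℕ a) P)
S'≡∑countX N prev []       []         = sym (sum-replicate-zero N)
S'≡∑countX N prev (l ∷ ls) (ul ∷ uls) = begin
  length X + S' X ls
    ≡⟨ cong₂ _+_ (length≡∑mem N X (remove-UniqueBelow prev ul)) (S'≡∑countX N X ls uls) ⟩
  ∑[ a < N ] χ (mem (toℕ a) X) + ∑[ a < N ] countX (mem (toℕ a) X) (occurrences (toℕ a) ls)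
    ≡⟨ ∑-distrib-+ {N} _ _ ⟨
  ∑[ a < N ] (χ (mem (toℕ a) X) + countX (mem (toℕ a) X) (occurrences (toℕ a) ls))
    ≡⟨ sum-cong-≗ {N} (λ a → cong (λ b → χ b + countX b (occurrences (toℕ a) ls)) (mem-remove (toℕ a) prev l)) ⟩
  ∑[ a < N ] countX (mem (toℕ a) prev) (occurrences (toℕ a) (l ∷ ls)) ∎
  where
  open ≡-Reasoning
  X : List ℕ
  X = remove prev l

occurrences-restrictPQ : ∀ a p q P →
  occurrences a (restrictPQ p q P) ≡ trim (mem a p) (mem a q) (occurrences a P)
occurrences-restrictPQ a p q []       = refl
occurrences-restrictPQ a p q (l ∷ ls) = trans (occurrences-onLast (remove p l ∷ ls))
  (cong (λ b → mapLast (_∖ mem a q) (b ∷ occurrences a ls)) (mem-remove a p l))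
  where
  occurrences-onLast : ∀ P → occurrences a (onLast (remove q) P) ≡ mapLast (_∖ mem a q) (occurrences a P)
  occurrences-onLast []            = refl
  occurrences-onLast (l ∷ [])      = cong (_∷ []) (mem-remove a q l)
  occurrences-onLast (l ∷ l' ∷ ls) = cong (mem a l ∷_) (occurrences-onLast (l' ∷ ls))

module _ {Q : List ℕ → Set} {f : List ℕ → List ℕ} (f-resp : ∀ {l} → Q l → Q (f l)) where

  All-onHead : ∀ {P} → All Q P → All Q (onHead f P)
  All-onHead []         = []
  All-onHead (ql ∷ qls) = f-resp ql ∷ qls

  All-onLast : ∀ {P} → All Q P → All Q (onLast f P)
  All-onLast []                 = []
  All-onLast (ql ∷ [])          = f-resp ql ∷ []
  All-onLast (ql ∷ qls@(_ ∷ _)) = ql ∷ All-onLast qls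

S-restrictPQ≡∑countX : ∀ N p q P → All (UniqueBelow N) P →
  S (restrictPQ p q P) ≡ ∑[ a < N ] countX false (trim (mem (toℕ a) p) (mem (toℕ a) q) (occurrences (toℕ a) P))
S-restrictPQ≡∑countX N p q P uP = trans
  (S'≡∑countX N [] (restrictPQ p q P) (All-onLast (remove-UniqueBelow q) (All-onHead (remove-UniqueBelow p) uP)))
  (sum-cong-≗ {N} (λ a → cong (countX false) (occurrences-restrictPQ (toℕ a) p q P)))

∑oddSum≡oddSum-length  : ∀ N P → All (UniqueBelow N) P →
  ∑[ a < N ] oddSum χ (occurrences (toℕ a) P) ≡ oddSum length P
∑evenSum≡evenSum-length : ∀ N P → All (UniqueBelow N) P →
  ∑[ a < N ] evenSum χ (occurrences (toℕ a) P) ≡ evenSum length P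
∑oddSum≡oddSum-length N []       []         = sum-replicate-zero N
∑oddSum≡oddSum-length N (l ∷ ls) (ul ∷ uls) = trans (∑-distrib-+ {N} _ _)
  (cong₂ _+_ (sym (length≡∑mem N l ul)) (∑evenSum≡evenSum-length N ls uls))
∑evenSum≡evenSum-length N []       []        = sum-replicate-zero N
∑evenSum≡evenSum-length N (l ∷ ls) (_ ∷ uls) = ∑oddSum≡oddSum-length N ls uls

colourBound : List (List ℕ) → ℕ
colourBound P = suc (max 0 (concat P))

<colourBound : ∀ P → All (All (_< colourBound P)) P
<colourBound P = All.concat⁻ (All.map s≤s (xs≤max 0 (concat P)))

-- Couples and simple pairs

lookup-injective : ∀ {n} (v : Vec ℕ n) → Unique (toList v) → ∀ {i j} → lookup v i ≡ lookup v j → i ≡ j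
lookup-injective (x ∷ v) (x∉v ∷ u) {zero}  {zero}  _ = refl
lookup-injective (x ∷ v) (x∉v ∷ u) {zero}  {suc j} e = contradiction e (All.lookup x∉v (∈-toList⁺ (∈-lookup j v)))
lookup-injective (x ∷ v) (x∉v ∷ u) {suc i} {zero}  e = contradiction (sym e) (All.lookup x∉v (∈-toList⁺ (∈-lookup i v)))
lookup-injective (x ∷ v) (_   ∷ u) {suc i} {suc j} e = cong suc (lookup-injective v u e)

Touches : ∀ {n} → Vec ℕ n → Vec ℕ n → Fin n → ℕ → Set
Touches c c' j x = x ≡ lookup c j ⊎ x ≡ lookup c' j

touches? : ∀ {n} (c c' : Vec ℕ n) j x → Dec (Touches c c' j x)
touches? c c' j x = x ≟ lookup c j ⊎-dec x ≟ lookup c' j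

couples-disjoint : ∀ {n} (c c' : Vec ℕ n) → Unique (toList c) → Unique (toList c') →
  (∀ j → lookup c j ∈ toList c' → lookup c' j ≡ lookup c j) →
  ∀ {j k x} → Touches c c' j x → Touches c c' k x → j ≡ k
couples-disjoint c c' unique-c unique-c' shared = disjoint
  where
  injective : ∀ {i j} → lookup c i ≡ lookup c j → i ≡ j
  injective = lookup-injective c unique-c
  injective' : ∀ {i j} → lookup c' i ≡ lookup c' j → i ≡ j
  injective' = lookup-injective c' unique-c'
  shared-index : ∀ {j k} → lookup c j ≡ lookup c' k → j ≡ k
  shared-index {j} {k} e = injective' (trans (shared j (subst (_∈ toList c') (sym e) (∈-toList⁺ (∈-lookup k c')))) e)
  disjoint : ∀ {j k x} → Touches c c' j x → Touches c c' k x → j ≡ k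
  disjoint (inj₁ refl) (inj₁ e) = injective e
  disjoint (inj₁ refl) (inj₂ e) = shared-index e
  disjoint (inj₂ refl) (inj₁ e) = sym (shared-index (sym e))
  disjoint (inj₂ refl) (inj₂ e) = injective' e

module _ (v : Vec ℕ 4) where

  ∈-colsOf⁺ : ∀ {j s} → j Subset.∈ s → lookup v j ∈ colsOf v s
  ∈-colsOf⁺ {j} j∈s = ∈-map⁺ (lookup v) (∈-filter⁺ (_∈?ˢ _) (∈-allFin j) j∈s)

  ∈-colsOf⁻ : (∀ {i j} → lookup v i ≡ lookup v j → i ≡ j) → ∀ {j s} → lookup v j ∈ colsOf v s → j Subset.∈ s
  ∈-colsOf⁻ injective {s = s} vj∈ with ∈-map⁻ (lookup v) vj∈
  ... | i , i∈ , vj≡vi = subst (Subset._∈ s) (sym (injective vj≡vi)) (proj₂ (∈-filter⁻ (_∈?ˢ s) {xs = allFin 4} i∈))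

simplePair⇒≡ : ∀ {c c' p q} → (∀ {i j} → lookup c i ≡ lookup c j → i ≡ j) →
  (∀ {i j} → lookup c' i ≡ lookup c' j → i ≡ j) → SimplePair c c' p q → p ≡ q
simplePair⇒≡ {c} {c'} injective injective' (_ , _ , c∈p⇔c'∈q) = ⊆-antisym
  (λ j∈p → ∈-colsOf⁻ c' injective' (Equivalence.to   (c∈p⇔c'∈q _) (∈-colsOf⁺ c j∈p)))
  (λ j∈q → ∈-colsOf⁻ c  injective  (Equivalence.from (c∈p⇔c'∈q _) (∈-colsOf⁺ c' j∈q)))

endpoints : Fin 6 → Fin 4 × Fin 4
endpoints = lookup ((0F , 1F) ∷ (0F , 2F) ∷ (0F , 3F) ∷ (1F , 2F) ∷ (1F , 3F) ∷ (2F , 3F) ∷ [])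

pairSubset : Fin 6 → Subset 4
pairSubset k = ⁅ proj₁ (endpoints k) ⁆ ∪ ⁅ proj₂ (endpoints k) ⁆

endpoints-distinct : ∀ k → proj₁ (endpoints k) ≢ proj₂ (endpoints k)
endpoints-distinct 0F ()
endpoints-distinct 1F ()
endpoints-distinct 2F ()
endpoints-distinct 3F ()
endpoints-distinct 4F ()
endpoints-distinct 5F ()

size-two : (p : Subset 4) → Subset.∣ p ∣ ≡ 2 → Σ (Fin 6) λ k → p ≡ pairSubset k
size-two (true  ∷ true  ∷ true  ∷ true  ∷ []) ()
size-two (true  ∷ true  ∷ true  ∷ false ∷ []) ()
size-two (true  ∷ true  ∷ false ∷ true  ∷ []) ()
size-two (true  ∷ true  ∷ false ∷ false ∷ []) _ = 0F , refl
size-two (true  ∷ false ∷ true  ∷ true  ∷ []) ()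
size-two (true  ∷ false ∷ true  ∷ false ∷ []) _ = 1F , refl
size-two (true  ∷ false ∷ false ∷ true  ∷ []) _ = 2F , refl
size-two (true  ∷ false ∷ false ∷ false ∷ []) ()
size-two (false ∷ true  ∷ true  ∷ true  ∷ []) ()
size-two (false ∷ true  ∷ true  ∷ false ∷ []) _ = 3F , refl
size-two (false ∷ true  ∷ false ∷ true  ∷ []) _ = 4F , refl
size-two (false ∷ true  ∷ false ∷ false ∷ []) ()
size-two (false ∷ false ∷ true  ∷ true  ∷ []) _ = 5F , refl
size-two (false ∷ false ∷ true  ∷ false ∷ []) ()
size-two (false ∷ false ∷ false ∷ true  ∷ []) ()
size-two (false ∷ false ∷ false ∷ false ∷ []) ()

colsOf-pairSubset : ∀ v k →
  colsOf v (pairSubset k) ≡ lookup v (proj₁ (endpoints k)) ∷ lookup v (proj₂ (endpoints k)) ∷ []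
colsOf-pairSubset v 0F = refl
colsOf-pairSubset v 1F = refl
colsOf-pairSubset v 2F = refl
colsOf-pairSubset v 3F = refl
colsOf-pairSubset v 4F = refl
colsOf-pairSubset v 5F = refl

-- Damages of the four couples

Heavy : Vec ℕ 4 → ℕ → Fin 6 → Set
Heavy κ σ k = σ + 3 ≤ lookup κ (proj₁ (endpoints k)) + lookup κ (proj₂ (endpoints k))

multiplicity : Vec ℕ 4 → ℕ → ℕ
multiplicity κ v = length (filter (λ j → lookup κ j ≟ v) (allFin 4))

AtMostTwoHeavy : Vec ℕ 4 → ℕ → Set
AtMostTwoHeavy κ σ =
  ∀ k₁ k₂ k₃ → k₁ ≢ k₂ → k₁ ≢ k₃ → k₂ ≢ k₃ → Heavy κ σ k₁ → Heavy κ σ k₂ → ¬ Heavy κ σ k₃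

TwoHeavy⇒Shape : Vec ℕ 4 → ℕ → Set
TwoHeavy⇒Shape κ σ = ∀ k₁ k₂ → k₁ ≢ k₂ → Heavy κ σ k₁ → Heavy κ σ k₂ →
  σ ≡ 0 × multiplicity κ 2 ≡ 1 × multiplicity κ 1 ≡ 2

Budgeted⇒Shapes : Vec ℕ 4 → ℕ → Set
Budgeted⇒Shapes κ σ = ∑[ j < 4 ] lookup κ j ≤ σ + 4 → AtMostTwoHeavy κ σ × TwoHeavy⇒Shape κ σ

budgeted⇒shapes? : ∀ κ σ → Dec (Budgeted⇒Shapes κ σ)
budgeted⇒shapes? κ σ = ∑[ j < 4 ] lookup κ j ≤? σ + 4 →-dec
  (all? λ k₁ → all? λ k₂ → all? λ k₃ → ¬? (k₁ Fin.≟ k₂) →-dec ¬? (k₁ Fin.≟ k₃) →-dec ¬? (k₂ Fin.≟ k₃) →-dec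
     heavy? k₁ →-dec heavy? k₂ →-dec ¬? (heavy? k₃))
  ×-dec
  (all? λ k₁ → all? λ k₂ → ¬? (k₁ Fin.≟ k₂) →-dec heavy? k₁ →-dec heavy? k₂ →-dec
     (σ ≟ 0 ×-dec multiplicity κ 2 ≟ 1 ×-dec multiplicity κ 1 ≟ 2))
  where
  heavy? : ∀ k → Dec (Heavy κ σ k)
  heavy? k = σ + 3 ≤? _

∀<-fromFin : ∀ {P : ℕ → Set} n → (∀ (i : Fin n) → P (toℕ i)) → ∀ x → x < n → P x
∀<-fromFin {P} n P-toℕ x x<n = subst P (Fin.toℕ-fromℕ< x<n) (P-toℕ (fromℕ< x<n))

-- Checked by evaluating the decision procedure on all κ ∈ {0,1,2}⁴, σ ∈ {0,1}.
budgeted⇒shapes : ∀ κ₀ → κ₀ < 3 → ∀ κ₁ → κ₁ < 3 → ∀ κ₂ → κ₂ < 3 → ∀ κ₃ → κ₃ < 3 → ∀ σ → σ < 2 →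
  Budgeted⇒Shapes (κ₀ ∷ κ₁ ∷ κ₂ ∷ κ₃ ∷ []) σ
budgeted⇒shapes =
  ∀<-fromFin 3 λ x₀ → ∀<-fromFin 3 λ x₁ → ∀<-fromFin 3 λ x₂ → ∀<-fromFin 3 λ x₃ → ∀<-fromFin 2 λ s →
  toWitness {a? = all? λ x₀ → all? λ x₁ → all? λ x₂ → all? λ x₃ → all? λ s →
                    budgeted⇒shapes? (toℕ x₀ ∷ toℕ x₁ ∷ toℕ x₂ ∷ toℕ x₃ ∷ []) (toℕ s)} _ x₀ x₁ x₂ x₃ s

-<-cancelˡ : ∀ s n t → ℤ.+ s ℤ.- ℤ.+ n ℤ.< ℤ.+ s ℤ.- ℤ.+ t → t < n
-<-cancelˡ s n t lt = ≰⇒> λ n≤t →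
  ℤ.<⇒≱ (subst₂ ℤ._<_ (ℤ.m-n≡m⊖n s n) (ℤ.m-n≡m⊖n s t) lt) (ℤ.⊖-monoʳ-≥-≤ s n≤t)


module OddPath (P : List (List ℕ)) (m : ℕ) (length-P : length P ≡ suc (m + m))
  (unique-P : All Unique P) (size-P : All (λ l → length l ≡ 4) P) (c c' : Vec ℕ 4)
  (disjoint : ∀ {j k x} → Touches c c' j x → Touches c c' k x → j ≡ k) where

  N : ℕ
  N = colourBound P

  below-N : All (UniqueBelow N) P
  below-N = All.zip (unique-P , <colourBound P)

  occ : Fin N → List Bool
  occ a = occurrences (toℕ a) P

  length-occ : ∀ a → length (occ a) ≡ suc (m + m)
  length-occ a = trans (length-map (mem (toℕ a)) P) length-P

  colourS : Fin N → ℕ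
  colourS a = countX false (occ a)

  colourS^ : List ℕ → List ℕ → Fin N → ℕ
  colourS^ p q a = countX false (trim (mem (toℕ a) p) (mem (toℕ a) q) (occ a))

  S^ : List ℕ → List ℕ → ℕ
  S^ p q = S (restrictPQ p q P)

  S≡∑colourS : S P ≡ ∑[ a < N ] colourS a
  S≡∑colourS = S'≡∑countX N [] P below-N

  S^≡∑colourS^ : ∀ p q → S^ p q ≡ ∑[ a < N ] colourS^ p q a
  S^≡∑colourS^ p q = S-restrictPQ≡∑countX N p q P below-N

  colourS^-unchanged : ∀ {p q} a → mem (toℕ a) p ≡ false → mem (toℕ a) q ≡ false → colourS^ p q a ≡ colourS a
  colourS^-unchanged a a∉p a∉q = trans (cong₂ (λ hp hq → countX false (trim hp hq (occ a))) a∉p a∉q)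
                                       (cong (countX false) (trim-false-false (occ a)))

  is-c is-c' : Fin 4 → Fin N → Bool
  is-c  j a = mem (toℕ a) (lookup c j ∷ [])
  is-c' j a = mem (toℕ a) (lookup c' j ∷ [])

  Sᶜ : Fin 4 → ℕ
  Sᶜ j = S^ (lookup c j ∷ []) (lookup c' j ∷ [])

  colourSᶜ : Fin 4 → Fin N → ℕ
  colourSᶜ j = colourS^ (lookup c j ∷ []) (lookup c' j ∷ [])

  Sᶜ≡∑colourSᶜ : ∀ j → Sᶜ j ≡ ∑[ a < N ] colourSᶜ j a
  Sᶜ≡∑colourSᶜ j = S^≡∑colourS^ (lookup c j ∷ []) (lookup c' j ∷ [])

  colourSᶜ-untouched : ∀ {j} a → ¬ Touches c c' j (toℕ a) → colourSᶜ j a ≡ colourS a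
  colourSᶜ-untouched {j} a ¬touches = colourS^-unchanged {lookup c j ∷ []} {lookup c' j ∷ []} a
    (mem-∷-≢ [] (¬touches ∘ inj₁)) (mem-∷-≢ [] (¬touches ∘ inj₂))

  Sᶜ≤S : ∀ j → Sᶜ j ≤ S P
  Sᶜ≤S j = begin
    Sᶜ j                     ≡⟨ Sᶜ≡∑colourSᶜ j ⟩
    ∑[ a < N ] colourSᶜ j a  ≤⟨ ∑-mono-≤ (λ a → countX-trim-≤ (is-c j a) (is-c' j a) (occ a)) ⟩
    ∑[ a < N ] colourS a     ≡⟨ S≡∑colourS ⟨
    S P                      ∎
    where open ≤-Reasoning

  S≤Sᶜ+2 : ∀ j → S P ≤ Sᶜ j + 2
  S≤Sᶜ+2 j = begin
    S P
      ≡⟨ S≡∑colourS ⟩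
    ∑[ a < N ] colourS a
      ≤⟨ ∑-mono-≤ (λ a → countX-≤-trim (is-c j a) (is-c' j a) (occ a)) ⟩
    ∑[ a < N ] (colourSᶜ j a + χ (is-c j a) + χ (is-c' j a))
      ≡⟨ trans (∑-distrib-+ {N} (λ a → colourSᶜ j a + χ (is-c j a)) (χ ∘ is-c' j))
               (cong (_+ ∑[ a < N ] χ (is-c' j a)) (∑-distrib-+ {N} (colourSᶜ j) (χ ∘ is-c j))) ⟩
    ∑[ a < N ] colourSᶜ j a + ∑[ a < N ] χ (is-c j a) + ∑[ a < N ] χ (is-c' j a)
      ≤⟨ +-mono-≤ (+-monoʳ-≤ _ (∑χ-mem-singleton≤1 N (lookup c j))) (∑χ-mem-singleton≤1 N (lookup c' j)) ⟩
    ∑[ a < N ] colourSᶜ j a + 1 + 1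
      ≡⟨ cong (λ s → s + 1 + 1) (Sᶜ≡∑colourSᶜ j) ⟨
    Sᶜ j + 1 + 1
      ≡⟨ +-assoc (Sᶜ j) 1 1 ⟩
    Sᶜ j + 2 ∎
    where open ≤-Reasoning

  4[1+m]≤S : 4 * suc m ≤ S P
  4[1+m]≤S = begin
    4 * suc m                    ≡⟨ cong (4 *_) ⌈length/2⌉≡1+m ⟨
    4 * ⌈ length P /2⌉           ≡⟨ oddSum-const length 4 P size-P ⟨
    oddSum length P              ≡⟨ ∑oddSum≡oddSum-length N P below-N ⟨
    ∑[ a < N ] oddSum χ (occ a)  ≤⟨ ∑-mono-≤ (λ a → oddSum≤countX false (occ a)) ⟩
    ∑[ a < N ] colourS a         ≡⟨ S≡∑colourS ⟨
    S P                          ∎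
    where
    open ≤-Reasoning
    ⌈length/2⌉≡1+m : ⌈ length P /2⌉ ≡ suc m
    ⌈length/2⌉≡1+m = trans (cong ⌈_/2⌉ length-P) (cong suc (sym (n≡⌊n+n/2⌋ m)))

  ∑evenSum≡4m : ∑[ a < N ] evenSum χ (occ a) ≡ 4 * m
  ∑evenSum≡4m = begin
    ∑[ a < N ] evenSum χ (occ a)  ≡⟨ ∑evenSum≡evenSum-length N P below-N ⟩
    evenSum length P              ≡⟨ evenSum-const length 4 P size-P ⟩
    4 * ⌊ length P /2⌋            ≡⟨ cong (λ n → 4 * ⌊ n /2⌋) length-P ⟩
    4 * ⌈ m + m /2⌉               ≡⟨ cong (4 *_) (n≡⌈n+n/2⌉ m) ⟨
    4 * m                         ∎
    where open ≡-Reasoning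

  at-most-one-couple : ∀ a j k → j ≢ k → colourSᶜ j a ≡ colourS a ⊎ colourSᶜ k a ≡ colourS a
  at-most-one-couple a j k j≢k with touches? c c' j (toℕ a)
  ... | no  ¬touches-j = inj₁ (colourSᶜ-untouched a ¬touches-j)
  ... | yes touches-j  = inj₂ (colourSᶜ-untouched a (j≢k ∘ disjoint touches-j))

  -- Per colour: at most one couple touches it, and removing it at the (odd) ends of P
  -- leaves at least its occurrences at even positions.
  budget : 3 * S P + 4 * m ≤ ∑[ j < 4 ] Sᶜ j
  budget = begin
    3 * S P + 4 * m
      ≡⟨ cong₂ _+_ (cong (3 *_) S≡∑colourS) (sym ∑evenSum≡4m) ⟩
    3 * ∑[ a < N ] colourS a + ∑[ a < N ] evenSum χ (occ a)
      ≡⟨ cong (_+ ∑[ a < N ] evenSum χ (occ a)) (*-distribˡ-sum 3 colourS) ⟩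
    ∑[ a < N ] (3 * colourS a) + ∑[ a < N ] evenSum χ (occ a)
      ≡⟨ ∑-distrib-+ {N} (λ a → 3 * colourS a) (λ a → evenSum χ (occ a)) ⟨
    ∑[ a < N ] (3 * colourS a + evenSum χ (occ a))
      ≤⟨ ∑-mono-≤ (λ a → ∑-≥-all-but-one 3 (λ j → colourSᶜ j a)
            (λ j → evenSum≤countX-trim m (is-c j a) (is-c' j a) (occ a) (length-occ a))
            (at-most-one-couple a)) ⟩
    ∑[ a < N ] ∑[ j < 4 ] colourSᶜ j a
      ≡⟨ ∑-comm (λ a j → colourSᶜ j a) ⟩
    ∑[ j < 4 ] ∑[ a < N ] colourSᶜ j a
      ≡⟨ sum-cong-≗ {4} Sᶜ≡∑colourSᶜ ⟨
    ∑[ j < 4 ] Sᶜ j ∎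
    where open ≤-Reasoning

  Sᵖ : Fin 4 → Fin 4 → ℕ
  Sᵖ j k = S^ (lookup c j ∷ lookup c k ∷ []) (lookup c' j ∷ lookup c' k ∷ [])

  colourSᵖ : Fin 4 → Fin 4 → Fin N → ℕ
  colourSᵖ j k = colourS^ (lookup c j ∷ lookup c k ∷ []) (lookup c' j ∷ lookup c' k ∷ [])

  colourSᵖ-untouchedʳ : ∀ {j k} a → ¬ Touches c c' k (toℕ a) → colourSᵖ j k a ≡ colourSᶜ j a
  colourSᵖ-untouchedʳ {j} a ¬touches = cong₂ (λ hp hq → countX false (trim hp hq (occ a)))
    (cong (does (toℕ a ≟ lookup c j) ∨_) (mem-∷-≢ [] (¬touches ∘ inj₁)))
    (cong (does (toℕ a ≟ lookup c' j) ∨_) (mem-∷-≢ [] (¬touches ∘ inj₂)))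

  colourSᵖ-untouchedˡ : ∀ {j k} a → ¬ Touches c c' j (toℕ a) → colourSᵖ j k a ≡ colourSᶜ k a
  colourSᵖ-untouchedˡ {j} {k} a ¬touches = cong₂ (λ hp hq → countX false (trim hp hq (occ a)))
    (mem-∷-≢ (lookup c k ∷ []) (¬touches ∘ inj₁)) (mem-∷-≢ (lookup c' k ∷ []) (¬touches ∘ inj₂))

  colourSᵖ-additive : ∀ {j k} → j ≢ k → ∀ a → colourSᵖ j k a + colourS a ≡ colourSᶜ j a + colourSᶜ k a
  colourSᵖ-additive {j} {k} j≢k a with touches? c c' k (toℕ a)
  ... | no ¬touches-k =
    cong₂ _+_ (colourSᵖ-untouchedʳ a ¬touches-k) (sym (colourSᶜ-untouched a ¬touches-k))
  ... | yes touches-k = trans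
    (cong₂ _+_ (colourSᵖ-untouchedˡ a ¬touches-j) (sym (colourSᶜ-untouched a ¬touches-j)))
    (+-comm (colourSᶜ k a) (colourSᶜ j a))
    where
    ¬touches-j : ¬ Touches c c' j (toℕ a)
    ¬touches-j touches-j = j≢k (disjoint touches-j touches-k)

  Sᵖ-additive : ∀ {j k} → j ≢ k → Sᵖ j k + S P ≡ Sᶜ j + Sᶜ k
  Sᵖ-additive {j} {k} j≢k = begin
    Sᵖ j k + S P
      ≡⟨ cong₂ _+_ (S^≡∑colourS^ (lookup c j ∷ lookup c k ∷ []) (lookup c' j ∷ lookup c' k ∷ [])) S≡∑colourS ⟩
    ∑[ a < N ] colourSᵖ j k a + ∑[ a < N ] colourS a
      ≡⟨ ∑-distrib-+ {N} (colourSᵖ j k) colourS ⟨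
    ∑[ a < N ] (colourSᵖ j k a + colourS a)
      ≡⟨ sum-cong-≗ {N} (colourSᵖ-additive j≢k) ⟩
    ∑[ a < N ] (colourSᶜ j a + colourSᶜ k a)
      ≡⟨ ∑-distrib-+ {N} (colourSᶜ j) (colourSᶜ k) ⟩
    ∑[ a < N ] colourSᶜ j a + ∑[ a < N ] colourSᶜ k a
      ≡⟨ cong₂ _+_ (Sᶜ≡∑colourSᶜ j) (Sᶜ≡∑colourSᶜ k) ⟨
    Sᶜ j + Sᶜ k ∎
    where open ≡-Reasoning

  κ : Fin 4 → ℕ
  κ j = S P ∸ Sᶜ j

  σ : ℕ
  σ = S P ∸ 4 * suc m

  Sᶜ+κ≡S : ∀ j → Sᶜ j + κ j ≡ S P
  Sᶜ+κ≡S j = m+[n∸m]≡n (Sᶜ≤S j)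

  4[1+m]+σ≡S : 4 * suc m + σ ≡ S P
  4[1+m]+σ≡S = m+[n∸m]≡n 4[1+m]≤S

  κ≤2 : ∀ j → κ j ≤ 2
  κ≤2 j = m≤n+o⇒m∸n≤o (S P) (Sᶜ j) (S≤Sᶜ+2 j)

  ∑κ≤σ+4 : ∑[ j < 4 ] κ j ≤ σ + 4
  ∑κ≤σ+4 = +-cancelˡ-≤ (3 * S P + 4 * m) _ _ (begin
    3 * S P + 4 * m + ∑[ j < 4 ] κ j  ≤⟨ +-monoˡ-≤ (∑[ j < 4 ] κ j) budget ⟩
    ∑[ j < 4 ] Sᶜ j + ∑[ j < 4 ] κ j  ≡⟨ ∑-distrib-+ {4} Sᶜ κ ⟨
    ∑[ j < 4 ] (Sᶜ j + κ j)           ≡⟨ ∑-const 4 Sᶜ+κ≡S ⟩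
    S P + 3 * S P                     ≡⟨ +-comm (S P) (3 * S P) ⟩
    3 * S P + S P                     ≡⟨ cong (3 * S P +_) 4[1+m]+σ≡S ⟨
    3 * S P + (4 * suc m + σ)         ≡⟨ rearrange (3 * S P) m σ ⟩
    3 * S P + 4 * m + (σ + 4)         ∎)
    where
    open ≤-Reasoning
    rearrange : ∀ s m σ → s + (4 * suc m + σ) ≡ s + 4 * m + (σ + 4)
    rearrange = solve-∀

  Sᵖ+κ+κ≡S : ∀ {j k} → j ≢ k → Sᵖ j k + (κ j + κ k) ≡ S P
  Sᵖ+κ+κ≡S {j} {k} j≢k = +-cancelʳ-≡ (S P) _ _ (begin
    Sᵖ j k + (κ j + κ k) + S P   ≡⟨ xy∙z≈xz∙y (Sᵖ j k) (κ j + κ k) (S P) ⟩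
    Sᵖ j k + S P + (κ j + κ k)   ≡⟨ cong (_+ (κ j + κ k)) (Sᵖ-additive j≢k) ⟩
    Sᶜ j + Sᶜ k + (κ j + κ k)    ≡⟨ interchange (Sᶜ j) (Sᶜ k) (κ j) (κ k) ⟩
    (Sᶜ j + κ j) + (Sᶜ k + κ k)  ≡⟨ cong₂ _+_ (Sᶜ+κ≡S j) (Sᶜ+κ≡S k) ⟩
    S P + S P                    ∎)
    where open ≡-Reasoning

  heavy-if-blocked : ∀ {j k} → j ≢ k → Sᵖ j k < 2 * length P → σ + 3 ≤ κ j + κ k
  heavy-if-blocked {j} {k} j≢k blocked = +-cancelˡ-≤ (2 * length P) _ _ (begin
    2 * length P + (σ + 3)      ≡⟨ cong (λ n → 2 * n + (σ + 3)) length-P ⟩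
    2 * suc (m + m) + (σ + 3)   ≡⟨ rearrange m σ ⟩
    suc (4 * suc m + σ)         ≡⟨ cong suc 4[1+m]+σ≡S ⟩
    suc (S P)                   ≡⟨ cong suc (Sᵖ+κ+κ≡S j≢k) ⟨
    suc (Sᵖ j k) + (κ j + κ k)  ≤⟨ +-monoˡ-≤ (κ j + κ k) blocked ⟩
    2 * length P + (κ j + κ k)  ∎)
    where
    open ≤-Reasoning
    rearrange : ∀ m σ → 2 * suc (m + m) + (σ + 3) ≡ suc (4 * suc m + σ)
    rearrange = solve-∀

  S≡2|P|+2 : σ ≡ 0 → S P ≡ 2 * length P + 2
  S≡2|P|+2 σ≡0 = begin
    S P                  ≡⟨ 4[1+m]+σ≡S ⟨
    4 * suc m + σ        ≡⟨ cong (4 * suc m +_) σ≡0 ⟩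
    4 * suc m + 0        ≡⟨ rearrange m ⟩
    2 * suc (m + m) + 2  ≡⟨ cong (λ n → 2 * n + 2) length-P ⟨
    2 * length P + 2     ∎
    where
    open ≡-Reasoning
    rearrange : ∀ m → 4 * suc m + 0 ≡ 2 * suc (m + m) + 2
    rearrange = solve-∀

  κs : Vec ℕ 4
  κs = tabulate κ

  blocked⇒heavy : ∀ {p q} → BlockedSimple P c c' p q →
    Σ (Fin 6) λ k → p ≡ pairSubset k × q ≡ pairSubset k × Heavy κs σ k
  blocked⇒heavy {p} {q} (simple , blocks) with size-two p (proj₁ simple)
  ... | k , refl = k , refl , sym p≡q , subst₂ (λ x y → σ + 3 ≤ x + y)
    (sym (lookup∘tabulate κ a)) (sym (lookup∘tabulate κ b))
    (heavy-if-blocked (endpoints-distinct k) (-<-cancelˡ (S P) (2 * length P) (Sᵖ a b) blocks-ab))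
    where
    a b : Fin 4
    a = proj₁ (endpoints k)
    b = proj₂ (endpoints k)
    p≡q : pairSubset k ≡ q
    p≡q = simplePair⇒≡ {c} {c'} (λ e → disjoint (inj₁ refl) (inj₁ e)) (λ e → disjoint (inj₂ refl) (inj₂ e)) simple
    blocks-ab : Blocks P (lookup c a ∷ lookup c b ∷ []) (lookup c' a ∷ lookup c' b ∷ [])
    blocks-ab = subst₂ (Blocks P) (colsOf-pairSubset c k)
      (trans (cong (colsOf c') (sym p≡q)) (colsOf-pairSubset c' k)) blocks

  shapes : ∀ k → Heavy κs σ k → AtMostTwoHeavy κs σ × TwoHeavy⇒Shape κs σ
  shapes k heavy = budgeted⇒shapes (κ 0F) (s≤s (κ≤2 0F)) (κ 1F) (s≤s (κ≤2 1F)) (κ 2F) (s≤s (κ≤2 2F))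
    (κ 3F) (s≤s (κ≤2 3F)) σ σ<2 ∑κ≤σ+4
    where
    κs≤2 : ∀ j → lookup κs j ≤ 2
    κs≤2 j = subst (_≤ 2) (sym (lookup∘tabulate κ j)) (κ≤2 j)
    σ<2 : σ < 2
    σ<2 = +-cancelʳ-≤ 3 (suc σ) 2
      (s≤s (≤-trans heavy (+-mono-≤ (κs≤2 (proj₁ (endpoints k))) (κs≤2 (proj₂ (endpoints k))))))

  distinct-codes : ∀ {k₁ k₂} → (pairSubset k₁ , pairSubset k₁) ≢ (pairSubset k₂ , pairSubset k₂) → k₁ ≢ k₂
  distinct-codes ne refl = ne refl

  coupleDam≡κ : ∀ j → coupleDam P c c' j ≡ ℤ.+ lookup κs j
  coupleDam≡κ j = trans (ℤ.m-n≡m⊖n (S P) (Sᶜ j))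
    (trans (ℤ.⊖-≥ (Sᶜ≤S j)) (cong ℤ.+_ (sym (lookup∘tabulate κ j))))

  numCouples≡multiplicity : ∀ v → numCouples P c c' v ≡ multiplicity κs v
  numCouples≡multiplicity v = cong length (filter-≐
    (λ j → coupleDam P c c' j ℤ.≟ ℤ.+ v) (λ j → lookup κs j ≟ v)
    ((λ {j} e → ℤ.+-injective (trans (sym (coupleDam≡κ j)) e)) , (λ {j} e → trans (coupleDam≡κ j) (cong ℤ.+_ e)))
    (allFin 4))

  at-most-two-blocked : (p₁ q₁ p₂ q₂ p₃ q₃ : Subset 4) →
    (p₁ , q₁) ≢ (p₂ , q₂) → (p₁ , q₁) ≢ (p₃ , q₃) → (p₂ , q₂) ≢ (p₃ , q₃) →
    BlockedSimple P c c' p₁ q₁ → BlockedSimple P c c' p₂ q₂ → ¬ BlockedSimple P c c' p₃ q₃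
  at-most-two-blocked p₁ q₁ p₂ q₂ p₃ q₃ d₁₂ d₁₃ d₂₃ b₁ b₂ b₃
    with blocked⇒heavy {p₁} {q₁} b₁ | blocked⇒heavy {p₂} {q₂} b₂ | blocked⇒heavy {p₃} {q₃} b₃
  ... | k₁ , refl , refl , h₁ | k₂ , refl , refl , h₂ | k₃ , refl , refl , h₃ =
    proj₁ (shapes k₁ h₁) k₁ k₂ k₃ (distinct-codes d₁₂) (distinct-codes d₁₃) (distinct-codes d₂₃) h₁ h₂ h₃

  two-blocked⇒shape : (p₁ q₁ p₂ q₂ : Subset 4) → (p₁ , q₁) ≢ (p₂ , q₂) →
    BlockedSimple P c c' p₁ q₁ → BlockedSimple P c c' p₂ q₂ →
    S P ≡ 2 * length P + 2 × numCouples P c c' 2 ≡ 1 × numCouples P c c' 1 ≡ 2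
  two-blocked⇒shape p₁ q₁ p₂ q₂ d₁₂ b₁ b₂ with blocked⇒heavy {p₁} {q₁} b₁ | blocked⇒heavy {p₂} {q₂} b₂
  ... | k₁ , refl , refl , h₁ | k₂ , refl , refl , h₂ =
    let σ≡0 , one-heavy , two-light = proj₂ (shapes k₁ h₁) k₁ k₂ (distinct-codes d₁₂) h₁ h₂ in
    S≡2|P|+2 σ≡0 , trans (numCouples≡multiplicity 2) one-heavy , trans (numCouples≡multiplicity 1) two-light

lemma4p4 : (k : ℕ) → 2 ≤ k → (len : Fin k → ℕ) → ((i : Fin k) → 1 ≤ len i) →
    (c c' : Vec ℕ 4) → (Lp : (i : Fin k) → Vec (List ℕ) (len i)) →
    Unique (toList c) → Unique (toList c') →
    ((i : Fin k) (x : Fin (len i)) →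
      Unique (lookup (Lp i) x) × length (lookup (Lp i) x) ≡ 4) →
    ((j : Fin 4) → lookup c j ∈ toList c' → lookup c' j ≡ lookup c j) →
    (i : Fin k) → Odd (len i) →
    ((p₁ q₁ p₂ q₂ p₃ q₃ : Subset 4) →
       (p₁ , q₁) ≢ (p₂ , q₂) → (p₁ , q₁) ≢ (p₃ , q₃) → (p₂ , q₂) ≢ (p₃ , q₃) →
       BlockedSimple (toList (Lp i)) c c' p₁ q₁ →
       BlockedSimple (toList (Lp i)) c c' p₂ q₂ →
       ¬ BlockedSimple (toList (Lp i)) c c' p₃ q₃)
    ×
    ((p₁ q₁ p₂ q₂ : Subset 4) → (p₁ , q₁) ≢ (p₂ , q₂) →
       BlockedSimple (toList (Lp i)) c c' p₁ q₁ →
       BlockedSimple (toList (Lp i)) c c' p₂ q₂ →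
       (S (toList (Lp i)) ≡ 2 * len i + 2)
       × numCouples (toList (Lp i)) c c' 2 ≡ 1
       × numCouples (toList (Lp i)) c c' 1 ≡ 2)
lemma4p4 _ _ _ _ c c' Lp unique-c unique-c' lists shared i (m , odd) =
  at-most-two-blocked ,
  λ p₁ q₁ p₂ q₂ d₁₂ b₁ b₂ →
    map₁ (λ S≡ → trans S≡ (cong (λ n → 2 * n + 2) (length-toList (Lp i))))
         (two-blocked⇒shape p₁ q₁ p₂ q₂ d₁₂ b₁ b₂)
  where
  length-P : length (toList (Lp i)) ≡ suc (m + m)
  length-P = trans (length-toList (Lp i)) (trans odd (cong (λ n → suc (m + n)) (+-identityʳ m)))
  open OddPath (toList (Lp i)) m length-P
    (VecAll.toList⁺ (VecAll.lookup⁻ (proj₁ ∘ lists i))) (VecAll.toList⁺ (VecAll.lookup⁻ (proj₂ ∘ lists i)))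
    c c' (couples-disjoint c c' unique-c unique-c' shared)
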